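{- If $G$ is a connected graph of order $n\geq 3$, then $b_{dR}(G)\leq \delta(G)+2\Delta(G)-3$.
   Context: All graphs are finite, simple and undirected. $\delta(G)$ and $\Delta(G)$ denote the minimum and maximum degree of $G$. For a graph $G=(V,E)$, a double Roman dominating function (DRDF) is a function $f:V\to\{0,1,2,3\}$ such that every vertex $v$ with $f(v)=0$ has at least two neighbors $u$ with $f(u)=2$ or at least one neighbor $w$ with $f(w)=3$, and every vertex $v$ with $f(v)=1$ has at least one neighbor $w$ with $f(w)\geq 2$. The weight of $f$ is $\sum_{u\in V}f(u)$, and $\gamma_{dR}(G)$ is the minimum weight of a DRDF on $G$. The double Roman bondage number $b_{dR}(G)$ is the minimum cardinality of an edge set $B\subseteq E(G)$ such that $\gamma_{dR}(G-B)>\gamma_{dR}(G)$. -}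

module Defs where

open import Data.Nat using (ℕ; zero; suc; _+_; _*_; _∸_; _≤_; _<_; _⊔_; _⊓_; _<ᵇ_)
open import Data.Fin using (Fin; toℕ)
open import Data.Bool using (Bool; true; false; _∧_; not; if_then_else_; T)
open import Data.List using (List; []; _∷_; map; allFin; foldr)
open import Data.Nat.ListAction using (sum)
open import Data.Product using (Σ; _×_; _,_; ∃)
open import Data.Sum using (_⊎_)
open import Relation.Binary.PropositionalEquality using (_≡_)

record Graph (n : ℕ) : Set where
  field
    adj   : Fin n → Fin n → Bool
    sym   : ∀ u v → adj u v ≡ adj v u
    irrefl : ∀ v → adj v v ≡ false
open Graph public

count : {n : ℕ} → (Fin n → Bool) → ℕ
count {n} p = sum (map (λ u → if p u then 1 else 0) (allFin n))

degree : {n : ℕ} → Graph n → Fin n → ℕ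
degree G v = count (adj G v)

δ : {m : ℕ} → Graph (suc m) → ℕ
δ {m} G = foldr (λ v acc → degree G v ⊓ acc) (degree G Fin.zero) (allFin (suc m))
  where import Data.Fin as Fin

Δ : {m : ℕ} → Graph (suc m) → ℕ
Δ {m} G = foldr (λ v acc → degree G v ⊔ acc) 0 (allFin (suc m))

data Reach {n : ℕ} (G : Graph n) : Fin n → Fin n → Set where
  here : ∀ {v} → Reach G v v
  step : ∀ {u w v} → T (adj G u w) → Reach G w v → Reach G u v

Connected : {n : ℕ} → Graph n → Set
Connected G = ∀ u v → Reach G u v

record EdgeSet {n : ℕ} (G : Graph n) : Set where
  field
    mem    : Fin n → Fin n → Bool
    memSym : ∀ u v → mem u v ≡ mem v u
    memSub : ∀ u v → T (mem u v) → T (adj G u v)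
open EdgeSet public

edgeCount : {n : ℕ} {G : Graph n} → EdgeSet G → ℕ
edgeCount {n} B = sum (map (λ u → count (λ v → (toℕ u <ᵇ toℕ v) ∧ mem B u v)) (allFin n))

deleteEdges : {n : ℕ} (G : Graph n) → EdgeSet G → Graph n
deleteEdges G B = record
  { adj = λ u v → adj G u v ∧ not (mem B u v)
  ; sym = λ u v → lemma u v
  ; irrefl = λ v → irr v }
  where
  open import Relation.Binary.PropositionalEquality using (cong₂)
  lemma : ∀ u v → (adj G u v ∧ not (mem B u v)) ≡ (adj G v u ∧ not (mem B v u))
  lemma u v = cong₂ (λ a b → a ∧ not b) (sym G u v) (memSym B u v)
  irr : ∀ v → (adj G v v ∧ not (mem B v v)) ≡ false
  irr v rewrite irrefl G v = Relation.Binary.PropositionalEquality.refl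
    where import Relation.Binary.PropositionalEquality

IsDRDF : {n : ℕ} → Graph n → (Fin n → ℕ) → Set
IsDRDF {n} G f =
  (∀ v → f v ≤ 3) ×
  (∀ v → f v ≡ 0 →
      (Σ (Fin n) λ u → Σ (Fin n) λ w →
         (u ≡ w → ⊥) × T (adj G v u) × f u ≡ 2 × T (adj G v w) × f w ≡ 2)
    ⊎ (Σ (Fin n) λ w → T (adj G v w) × f w ≡ 3)) ×
  (∀ v → f v ≡ 1 → Σ (Fin n) λ w → T (adj G v w) × 2 ≤ f w)
  where open import Data.Empty using (⊥)

weight : {n : ℕ} → (Fin n → ℕ) → ℕ
weight {n} f = sum (map f (allFin n))

IsDRDomNumber : {n : ℕ} → Graph n → ℕ → Set
IsDRDomNumber G k =
  (Σ _ λ f → IsDRDF G f × weight f ≡ k) × (∀ f → IsDRDF G f → k ≤ weight f)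

BondageAtMost : {n : ℕ} → Graph n → ℕ → Set
BondageAtMost G m =
  Σ (EdgeSet G) λ B → edgeCount B ≤ m ×
    (∀ k k' → IsDRDomNumber G k → IsDRDomNumber (deleteEdges G B) k' → k < k')

-- Take a vertex x of minimum degree; since G is connected with at least three
-- vertices, x lies on a path u – v – w with x ∈ {u, v}.  Let B be the set of
-- edges joining different blocks of the partition {u, v}, {w}, V ∖ {u, v, w}.
-- In G − B the edge uv is a component and w is isolated, so a double Roman
-- dominating function of G − B has weight at least 3 + 2 on {u, v, w};
-- relabelling u, w by 0 and v by 3 gives one of G that is lighter by at least 2,
-- hence γ_dR(G) < γ_dR(G − B).  Double counting edge ends shows
-- |B| ≤ deg u + deg v + deg w − 3 ≤ δ + 2Δ − 3.

module Submission where

open import Defs renaming (sym to adj-comm)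
open import Data.Bool using (Bool; true; false; _∧_; not; if_then_else_; T)
open import Data.Bool.Properties using (T-≡; T-∧)
open import Data.Empty using (⊥; ⊥-elim)
open import Data.Fin using (Fin; toℕ; _≟_; punchIn; punchOut) renaming (zero to fzero; suc to fsuc)
open import Data.Fin.Properties using (toℕ-injective; any?; punchInᵢ≢i; punchIn-injective; punchIn-punchOut)
open import Data.List using (List; []; _∷_; allFin; map; tabulate; foldr)
import Data.List.Properties as List
open import Data.List.Membership.Propositional using (_∈_)
open import Data.List.Membership.Propositional.Properties using (∈-allFin)
open import Data.List.Relation.Unary.Any using (here; there)
open import Data.Nat using (ℕ; zero; suc; _+_; _*_; _∸_; _≤_; _<_; _<ᵇ_; _≡ᵇ_; _⊓_; _⊔_; z≤n; s≤s)
import Data.Nat.ListAction as List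
open import Data.Nat.Properties
  using ( +-*-semiring; +-identityʳ; +-comm; +-assoc; +-mono-≤; +-monoʳ-≤; +-monoˡ-≤; +-cancelʳ-≤
        ; *-zeroʳ; *-identityʳ; *-cancelˡ-≤; *-distribˡ-+
        ; ≤-refl; ≤-reflexive; ≤-trans; <-≤-trans; <-asym; <-cmp; m≤n+m; m<m+n; m+n≤o⇒m≤o∸n; ∸-monoˡ-≤
        ; <ᵇ⇒<; <⇒<ᵇ; ≤ᵇ⇒≤; ≡ᵇ⇒≡; ⊓-sel; m≤m⊔n; m≤n⇒m≤o⊔n
        ; module ≤-Reasoning )
open import Data.Nat.Tactic.RingSolver using (solve-∀)
open import Algebra.Properties.Semiring.Sum +-*-semiring
  using (sum; sum-syntax; ∑-distrib-+; ∑-comm; sum-cong-≗; sum-replicate-zero)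
open import Data.Product using (Σ; _×_; _,_; proj₁; proj₂)
open import Data.Sum using (_⊎_; inj₁; inj₂; [_,_]′)
open import Data.Unit using (tt)
open import Function using (_∘_; Equivalence)
open Equivalence using (to; from)
open import Relation.Binary using (tri<; tri≈; tri>)
open import Relation.Binary.PropositionalEquality
open import Relation.Nullary using (¬_; does; yes; no; contradiction)
open import Relation.Nullary.Decidable using (T?; ¬?; _×-dec_; decidable-stable)

𝟙 : Bool → ℕ
𝟙 b = if b then 1 else 0

sum-map-allFin : ∀ {n} (g : Fin n → ℕ) → List.sum (map g (allFin n)) ≡ ∑[ i < n ] g i
sum-map-allFin {n} g = trans (cong List.sum (List.map-tabulate (λ i → i) g)) (sum-tabulate g)
  where
  sum-tabulate : ∀ {m} (h : Fin m → ℕ) → List.sum (tabulate h) ≡ sum h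
  sum-tabulate {zero} h = refl
  sum-tabulate {suc m} h = cong (h fzero +_) (sum-tabulate (λ i → h (fsuc i)))

∑-mono-≤ : ∀ {n} {g h : Fin n → ℕ} → (∀ i → g i ≤ h i) → sum g ≤ sum h
∑-mono-≤ {zero} g≤h = z≤n
∑-mono-≤ {suc n} g≤h = +-mono-≤ (g≤h fzero) (∑-mono-≤ (λ i → g≤h (fsuc i)))

∑-point : ∀ {n} (a : Fin n) (g : Fin n → ℕ) → ∑[ x < n ] (if does (x ≟ a) then g x else 0) ≡ g a
∑-point {suc n} fzero g = trans (cong (g fzero +_) (sum-replicate-zero n)) (+-identityʳ (g fzero))
∑-point (fsuc a) g = ∑-point a (λ x → g (fsuc x))

∑∑-distrib-+ : ∀ {n} (f g : Fin n → Fin n → ℕ) →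
  ∑[ x < n ] ∑[ y < n ] (f x y + g x y) ≡ ∑[ x < n ] ∑[ y < n ] f x y + ∑[ x < n ] ∑[ y < n ] g x y
∑∑-distrib-+ f g = trans (sum-cong-≗ (λ x → ∑-distrib-+ (f x) (g x))) (∑-distrib-+ (λ x → sum (f x)) (λ x → sum (g x)))

module _ {n : ℕ} {G : Graph n} where

  edgeCount-∑ : (B : EdgeSet G) →
    edgeCount B ≡ ∑[ x < n ] ∑[ y < n ] 𝟙 ((toℕ x <ᵇ toℕ y) ∧ mem B x y)
  edgeCount-∑ B = trans (sum-map-allFin (λ x → count (λ y → (toℕ x <ᵇ toℕ y) ∧ mem B x y)))
    (sum-cong-≗ (λ x → sum-map-allFin (λ y → 𝟙 ((toℕ x <ᵇ toℕ y) ∧ mem B x y))))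

  mem-irrefl : (B : EdgeSet G) → ∀ x → mem B x x ≡ false
  mem-irrefl B x with mem B x x in x~x
  ... | true  = ⊥-elim (subst T (irrefl G x) (memSub B x x (T-≡ .from x~x)))
  ... | false = refl

  private
    𝟙-mem-split : (B : EdgeSet G) → ∀ x y →
      𝟙 (mem B x y) ≡ 𝟙 ((toℕ x <ᵇ toℕ y) ∧ mem B x y) + 𝟙 ((toℕ y <ᵇ toℕ x) ∧ mem B y x)
    𝟙-mem-split B x y with toℕ x <ᵇ toℕ y in x<y | toℕ y <ᵇ toℕ x in y<x
    ... | true  | true  = ⊥-elim (<-asym (<ᵇ⇒< _ _ (T-≡ .from x<y)) (<ᵇ⇒< (toℕ y) (toℕ x) (T-≡ .from y<x)))
    ... | true  | false = sym (+-identityʳ _)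
    ... | false | true  = cong 𝟙 (memSym B x y)
    ... | false | false with <-cmp (toℕ x) (toℕ y)
    ...   | tri< p _ _ = contradiction (trans (sym x<y) (T-≡ .to (<⇒<ᵇ p))) λ ()
    ...   | tri> _ _ p = contradiction (trans (sym y<x) (T-≡ .to (<⇒<ᵇ p))) λ ()
    ...   | tri≈ _ p _ rewrite toℕ-injective p | mem-irrefl B y = refl

  handshake : (B : EdgeSet G) → ∑[ x < n ] ∑[ y < n ] 𝟙 (mem B x y) ≡ 2 * edgeCount B
  handshake B = begin
    ∑[ x < n ] ∑[ y < n ] 𝟙 (mem B x y)
      ≡⟨ sum-cong-≗ (λ x → trans (sum-cong-≗ (𝟙-mem-split B x)) (∑-distrib-+ (A x) (λ y → A y x))) ⟩
    ∑[ x < n ] (∑[ y < n ] A x y + ∑[ y < n ] A y x)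
      ≡⟨ ∑-distrib-+ (λ x → ∑[ y < n ] A x y) (λ x → ∑[ y < n ] A y x) ⟩
    E + ∑[ x < n ] ∑[ y < n ] A y x
      ≡⟨ cong (E +_) (sym (∑-comm A)) ⟩
    E + E
      ≡⟨ cong (E +_) (sym (+-identityʳ E)) ⟩
    2 * E
      ≡⟨ cong (2 *_) (sym (edgeCount-∑ B)) ⟩
    2 * edgeCount B ∎
    where
    open ≡-Reasoning
    A : Fin n → Fin n → ℕ
    A x y = 𝟙 ((toℕ x <ᵇ toℕ y) ∧ mem B x y)
    E : ℕ
    E = ∑[ x < n ] ∑[ y < n ] A x y

degree-∑ : ∀ {n} (G : Graph n) x → degree G x ≡ ∑[ y < n ] 𝟙 (adj G x y)
degree-∑ G x = sum-map-allFin (λ y → 𝟙 (adj G x y))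

≡ᵇ-sym : ∀ a b → (a ≡ᵇ b) ≡ (b ≡ᵇ a)
≡ᵇ-sym zero    zero    = refl
≡ᵇ-sym zero    (suc b) = refl
≡ᵇ-sym (suc a) zero    = refl
≡ᵇ-sym (suc a) (suc b) = ≡ᵇ-sym a b

crossEdges : ∀ {n} (G : Graph n) → (Fin n → ℕ) → EdgeSet G
crossEdges G c = record
  { mem    = λ x y → adj G x y ∧ not (c x ≡ᵇ c y)
  ; memSym = λ x y → cong₂ (λ a b → a ∧ not b) (adj-comm G x y) (≡ᵇ-sym (c x) (c y))
  ; memSub = λ x y → proj₁ ∘ T-∧ .to
  }

adj-deleteCross : ∀ {n} (G : Graph n) (c : Fin n → ℕ) {x y} →
  T (adj (deleteEdges G (crossEdges G c)) x y) → T (adj G x y) × c x ≡ c y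
adj-deleteCross G c {x} {y} x~y with adj G x y | c x ≡ᵇ c y in same
... | true | true = tt , ≡ᵇ⇒≡ (c x) (c y) (T-≡ .from same)

module _ {n : ℕ} (G : Graph n) where

  ZeroCondition : (Fin n → ℕ) → Fin n → Set
  ZeroCondition f v =
    (Σ (Fin n) λ u → Σ (Fin n) λ w →
       (u ≡ w → ⊥) × T (adj G v u) × f u ≡ 2 × T (adj G v w) × f w ≡ 2)
    ⊎ (Σ (Fin n) λ w → T (adj G v w) × f w ≡ 3)

  OneCondition : (Fin n → ℕ) → Fin n → Set
  OneCondition f v = Σ (Fin n) λ w → T (adj G v w) × 2 ≤ f w

  AdjacentOnlyTo : Fin n → Fin n → Set
  AdjacentOnlyTo u v = ∀ y → T (adj G u y) → y ≡ v

  Isolated : Fin n → Set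
  Isolated w = ∀ y → ¬ T (adj G w y)

  module _ {f : Fin n → ℕ} (drdf : IsDRDF G f) where

    private
      zero-ok : ∀ v → f v ≡ 0 → ZeroCondition f v
      zero-ok = proj₁ (proj₂ drdf)
      one-ok : ∀ v → f v ≡ 1 → OneCondition f v
      one-ok = proj₂ (proj₂ drdf)

    isolated⇒2≤ : ∀ {w} → Isolated w → 2 ≤ f w
    isolated⇒2≤ {w} isolated with f w in fw
    ... | 0 with zero-ok w fw
    ...   | inj₁ (y , _ , _ , w~y , _) = contradiction w~y (isolated y)
    ...   | inj₂ (y , w~y , _)         = contradiction w~y (isolated y)
    isolated⇒2≤ {w} isolated | 1 with one-ok w fw
    ...   | y , w~y , _ = contradiction w~y (isolated y)
    isolated⇒2≤ {w} isolated | suc (suc _) = s≤s (s≤s z≤n)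

    sole-neighbour-of-0 : ∀ {u v} → AdjacentOnlyTo u v → f u ≡ 0 → f v ≡ 3
    sole-neighbour-of-0 {u} {v} only fu with zero-ok u fu
    ... | inj₁ (y , z , y≢z , u~y , _ , u~z , _) = contradiction (trans (only y u~y) (sym (only z u~z))) y≢z
    ... | inj₂ (y , u~y , fy) = subst (λ z → f z ≡ 3) (only y u~y) fy

    sole-neighbour-of-1 : ∀ {u v} → AdjacentOnlyTo u v → f u ≡ 1 → 2 ≤ f v
    sole-neighbour-of-1 {u} {v} only fu with one-ok u fu
    ... | y , u~y , fy = subst (λ z → 2 ≤ f z) (only y u~y) fy

    isolatedEdge⇒3≤ : ∀ {u v} → AdjacentOnlyTo u v → AdjacentOnlyTo v u → 3 ≤ f u + f v
    isolatedEdge⇒3≤ {u} {v} u-v v-u = pair-bound (f u) (f v)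
      (sole-neighbour-of-0 u-v) (sole-neighbour-of-1 u-v) (sole-neighbour-of-0 v-u)
      where
      pair-bound : ∀ a b → (a ≡ 0 → b ≡ 3) → (a ≡ 1 → 2 ≤ b) → (b ≡ 0 → a ≡ 3) → 3 ≤ a + b
      pair-bound zero          b       b≡3 _   _   = ≤-reflexive (sym (b≡3 refl))
      pair-bound (suc zero)    b       _   2≤b _   = s≤s (2≤b refl)
      pair-bound (suc (suc a)) zero    _   _   a≡3 = ≤-reflexive (trans (sym (a≡3 refl)) (sym (+-identityʳ _)))
      pair-bound (suc (suc a)) (suc b) _   _   _   = s≤s (s≤s (≤-trans (s≤s z≤n) (m≤n+m (suc b) a)))

module _ {n : ℕ} (H G : Graph n) {f g : Fin n → ℕ} {x : Fin n}
  (lifts : ∀ y → T (adj H x y) → T (adj G x y) × g y ≡ f y) where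

  transfer-zero : ZeroCondition H f x → ZeroCondition G g x
  transfer-zero (inj₁ (y , z , y≢z , x~y , fy , x~z , fz)) with lifts y x~y | lifts z x~z
  ... | x~y′ , gy | x~z′ , gz = inj₁ (y , z , y≢z , x~y′ , trans gy fy , x~z′ , trans gz fz)
  transfer-zero (inj₂ (y , x~y , fy)) with lifts y x~y
  ... | x~y′ , gy = inj₂ (y , x~y′ , trans gy fy)

  transfer-one : OneCondition H f x → OneCondition G g x
  transfer-one (y , x~y , fy) with lifts y x~y
  ... | x~y′ , gy = y , x~y′ , subst (2 ≤_) (sym gy) fy

adj⇒≢ : ∀ {n} (G : Graph n) {x y} → T (adj G x y) → x ≢ y
adj⇒≢ G {x} x~x refl = subst T (irrefl G x) x~x

adj-sym : ∀ {n} (G : Graph n) {x y} → T (adj G x y) → T (adj G y x)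
adj-sym G {x} {y} = subst T (adj-comm G x y)

record P₃ {n : ℕ} (G : Graph n) : Set where
  field
    u v w : Fin n
    u~v   : T (adj G u v)
    w~v   : T (adj G w v)
    w≢u   : w ≢ u

data Role : Set where
  atU atV atW elsewhere : Role

module PathConstruction {n : ℕ} {G : Graph n} (p : P₃ G) where
  open P₃ p

  role : Fin n → Role
  role x with x ≟ u | x ≟ v | x ≟ w
  ... | yes _ | _     | _     = atU
  ... | no _  | yes _ | _     = atV
  ... | no _  | no _  | yes _ = atW
  ... | no _  | no _  | no _  = elsewhere

  role-u : role u ≡ atU
  role-u with u ≟ u
  ... | yes _  = refl
  ... | no u≢u = contradiction refl u≢u

  role-v : role v ≡ atV
  role-v with v ≟ u | v ≟ v
  ... | yes v≡u | _      = contradiction (sym v≡u) (adj⇒≢ G u~v)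
  ... | no _    | yes _  = refl
  ... | no _    | no v≢v = contradiction refl v≢v

  role-w : role w ≡ atW
  role-w with w ≟ u | w ≟ v | w ≟ w
  ... | yes w≡u | _       | _      = contradiction w≡u w≢u
  ... | no _    | yes w≡v | _      = contradiction w≡v (adj⇒≢ G w~v)
  ... | no _    | no _    | yes _  = refl
  ... | no _    | no _    | no w≢w = contradiction refl w≢w

  atU⇒≡u : ∀ {x} → role x ≡ atU → x ≡ u
  atU⇒≡u {x} with x ≟ u | x ≟ v | x ≟ w
  ... | yes x≡u | _     | _     = λ _ → x≡u
  ... | no _    | yes _ | _     = λ ()
  ... | no _    | no _  | yes _ = λ ()
  ... | no _    | no _  | no _  = λ ()

  atV⇒≡v : ∀ {x} → role x ≡ atV → x ≡ v
  atV⇒≡v {x} with x ≟ u | x ≟ v | x ≟ w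
  ... | yes _ | _       | _     = λ ()
  ... | no _  | yes x≡v | _     = λ _ → x≡v
  ... | no _  | no _    | yes _ = λ ()
  ... | no _  | no _    | no _  = λ ()

  atW⇒≡w : ∀ {x} → role x ≡ atW → x ≡ w
  atW⇒≡w {x} with x ≟ u | x ≟ v | x ≟ w
  ... | yes _ | _     | _       = λ ()
  ... | no _  | yes _ | _       = λ ()
  ... | no _  | no _  | yes x≡w = λ _ → x≡w
  ... | no _  | no _  | no _    = λ ()

  ∑-roles : (h : Role → Fin n → ℕ) → (∀ x → h elsewhere x ≡ 0) →
    ∑[ x < n ] h (role x) x ≡ h atU u + h atV v + h atW w
  ∑-roles h h-elsewhere = begin
    ∑[ x < n ] h (role x) x
      ≡⟨ sum-cong-≗ split ⟩
    ∑[ x < n ] (at u (h atU) x + at v (h atV) x + at w (h atW) x)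
      ≡⟨ ∑-distrib-+ (λ x → at u (h atU) x + at v (h atV) x) (at w (h atW)) ⟩
    ∑[ x < n ] (at u (h atU) x + at v (h atV) x) + ∑[ x < n ] at w (h atW) x
      ≡⟨ cong (_+ ∑[ x < n ] at w (h atW) x) (∑-distrib-+ (at u (h atU)) (at v (h atV))) ⟩
    ∑[ x < n ] at u (h atU) x + ∑[ x < n ] at v (h atV) x + ∑[ x < n ] at w (h atW) x
      ≡⟨ cong₂ _+_ (cong₂ _+_ (∑-point u (h atU)) (∑-point v (h atV))) (∑-point w (h atW)) ⟩
    h atU u + h atV v + h atW w ∎
    where
    open ≡-Reasoning
    at : Fin n → (Fin n → ℕ) → Fin n → ℕ
    at a g x = if does (x ≟ a) then g x else 0
    split : ∀ x → h (role x) x ≡ at u (h atU) x + at v (h atV) x + at w (h atW) x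
    split x with x ≟ u | x ≟ v | x ≟ w
    ... | yes refl | yes u≡v  | _        = contradiction u≡v (adj⇒≢ G u~v)
    ... | yes refl | no _     | yes w≡u  = contradiction (sym w≡u) w≢u
    ... | yes refl | no _     | no _     = sym (trans (+-identityʳ _) (+-identityʳ _))
    ... | no _     | yes refl | yes v≡w  = contradiction (sym v≡w) (adj⇒≢ G w~v)
    ... | no _     | yes refl | no _     = sym (+-identityʳ _)
    ... | no _     | no _     | yes refl = refl
    ... | no _     | no _     | no _     = h-elsewhere x

  block : Role → ℕ
  block atU       = 0
  block atV       = 0
  block atW       = 1
  block elsewhere = 2

  B : EdgeSet G
  B = crossEdges G (block ∘ role)

  onPath : Role → ℕ → ℕ
  onPath elsewhere _ = 0
  onPath _         k = k

  -- deg u + deg v + deg w counts uv twice although uv ∉ B, and vw twice although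
  -- B holds it once; slack records these surpluses as ordered pairs.
  slack : Role → Role → ℕ
  slack atU atV = 2
  slack atV atU = 2
  slack atV atW = 1
  slack atW atV = 1
  slack _   _   = 0

  crossing-table : ∀ r r′ → 𝟙 (not (block r ≡ᵇ block r′)) + slack r r′ ≤ onPath r 1 + onPath r′ 1
  crossing-table atU       atU       = ≤ᵇ⇒≤ _ _ tt
  crossing-table atU       atV       = ≤ᵇ⇒≤ _ _ tt
  crossing-table atU       atW       = ≤ᵇ⇒≤ _ _ tt
  crossing-table atU       elsewhere = ≤ᵇ⇒≤ _ _ tt
  crossing-table atV       atU       = ≤ᵇ⇒≤ _ _ tt
  crossing-table atV       atV       = ≤ᵇ⇒≤ _ _ tt
  crossing-table atV       atW       = ≤ᵇ⇒≤ _ _ tt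
  crossing-table atV       elsewhere = ≤ᵇ⇒≤ _ _ tt
  crossing-table atW       atU       = ≤ᵇ⇒≤ _ _ tt
  crossing-table atW       atV       = ≤ᵇ⇒≤ _ _ tt
  crossing-table atW       atW       = ≤ᵇ⇒≤ _ _ tt
  crossing-table atW       elsewhere = ≤ᵇ⇒≤ _ _ tt
  crossing-table elsewhere atU       = ≤ᵇ⇒≤ _ _ tt
  crossing-table elsewhere atV       = ≤ᵇ⇒≤ _ _ tt
  crossing-table elsewhere atW       = ≤ᵇ⇒≤ _ _ tt
  crossing-table elsewhere elsewhere = ≤ᵇ⇒≤ _ _ tt

  crossing-bound : ∀ x y →
    𝟙 (mem B x y) + slack (role x) (role y) * 𝟙 (adj G x y)
      ≤ onPath (role x) (𝟙 (adj G x y)) + onPath (role y) (𝟙 (adj G x y))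
  crossing-bound x y with adj G x y
  ... | false rewrite *-zeroʳ (slack (role x) (role y)) = z≤n
  ... | true  rewrite *-identityʳ (slack (role x) (role y)) = crossing-table (role x) (role y)

  ∑-onPath : ∀ r (h : Fin n → ℕ) → ∑[ y < n ] onPath r (h y) ≡ onPath r (∑[ y < n ] h y)
  ∑-onPath atU       h = refl
  ∑-onPath atV       h = refl
  ∑-onPath atW       h = refl
  ∑-onPath elsewhere h = sum-replicate-zero n

  path-degrees : ∑[ x < n ] ∑[ y < n ] onPath (role x) (𝟙 (adj G x y)) ≡ degree G u + degree G v + degree G w
  path-degrees = trans
    (sum-cong-≗ (λ x → trans (∑-onPath (role x) (λ y → 𝟙 (adj G x y))) (cong (onPath (role x)) (sym (degree-∑ G x)))))
    (∑-roles (λ r x → onPath r (degree G x)) (λ _ → refl))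

  path-degrees′ : ∑[ x < n ] ∑[ y < n ] onPath (role y) (𝟙 (adj G x y)) ≡ degree G u + degree G v + degree G w
  path-degrees′ = trans (∑-comm (λ x y → onPath (role y) (𝟙 (adj G x y))))
    (trans (sum-cong-≗ (λ y → sum-cong-≗ (λ x → cong (λ b → onPath (role y) (𝟙 b)) (adj-comm G x y)))) path-degrees)

  slack-sum : ∑[ x < n ] ∑[ y < n ] (slack (role x) (role y) * 𝟙 (adj G x y)) ≡ 6
  slack-sum
    rewrite ∑-roles (λ r x → ∑[ y < n ] (slack r (role y) * 𝟙 (adj G x y))) (λ _ → sum-replicate-zero n)
          | ∑-roles (λ r y → slack atU r * 𝟙 (adj G u y)) (λ _ → refl)
          | ∑-roles (λ r y → slack atV r * 𝟙 (adj G v y)) (λ _ → refl)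
          | ∑-roles (λ r y → slack atW r * 𝟙 (adj G w y)) (λ _ → refl)
          | T-≡ .to u~v | T-≡ .to (adj-sym G u~v) | T-≡ .to (adj-sym G w~v) | T-≡ .to w~v
          = refl

  edgeCount-bound : edgeCount B + 3 ≤ degree G u + degree G v + degree G w
  edgeCount-bound = *-cancelˡ-≤ 2 (begin
    2 * (edgeCount B + 3)                           ≡⟨ *-distribˡ-+ 2 (edgeCount B) 3 ⟩
    2 * edgeCount B + 6                             ≡⟨ cong₂ _+_ (handshake B) slack-sum ⟨
    ∑[ x < n ] ∑[ y < n ] crossing x y + ∑[ x < n ] ∑[ y < n ] spare x y
                                                    ≡⟨ ∑∑-distrib-+ crossing spare ⟨
    ∑[ x < n ] ∑[ y < n ] (crossing x y + spare x y) ≤⟨ ∑-mono-≤ (λ x → ∑-mono-≤ (crossing-bound x)) ⟩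
    ∑[ x < n ] ∑[ y < n ] (from-x x y + from-y x y)  ≡⟨ ∑∑-distrib-+ from-x from-y ⟩
    ∑[ x < n ] ∑[ y < n ] from-x x y + ∑[ x < n ] ∑[ y < n ] from-y x y
                                                    ≡⟨ cong₂ _+_ path-degrees path-degrees′ ⟩
    d + d                                           ≡⟨ cong (d +_) (+-identityʳ d) ⟨
    2 * d                                           ∎)
    where
    open ≤-Reasoning
    crossing spare from-x from-y : Fin n → Fin n → ℕ
    crossing x y = 𝟙 (mem B x y)
    spare    x y = slack (role x) (role y) * 𝟙 (adj G x y)
    from-x   x y = onPath (role x) (𝟙 (adj G x y))
    from-y   x y = onPath (role y) (𝟙 (adj G x y))
    d : ℕ
    d = degree G u + degree G v + degree G w

  G-B : Graph n
  G-B = deleteEdges G B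

  same-block : ∀ {x y} → T (adj G-B x y) → T (adj G x y) × block (role x) ≡ block (role y)
  same-block = adj-deleteCross G (block ∘ role)

  u-only-v : AdjacentOnlyTo G-B u v
  u-only-v y u~y with same-block u~y
  ... | u~′y , blocks with role u | role-u | role y in ry
  ...   | _ | refl | atU = contradiction (sym (atU⇒≡u ry)) (adj⇒≢ G u~′y)
  ...   | _ | refl | atV = atV⇒≡v ry

  v-only-u : AdjacentOnlyTo G-B v u
  v-only-u y v~y with same-block v~y
  ... | v~′y , blocks with role v | role-v | role y in ry
  ...   | _ | refl | atU = atU⇒≡u ry
  ...   | _ | refl | atV = contradiction (sym (atV⇒≡v ry)) (adj⇒≢ G v~′y)

  w-isolated : Isolated G-B w
  w-isolated y w~y with same-block w~y
  ... | w~′y , blocks with role w | role-w | role y in ry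
  ...   | _ | refl | atW = adj⇒≢ G w~′y (sym (atW⇒≡w ry))

  lift : Role → ℕ → ℕ
  lift atU       _ = 0
  lift atV       _ = 3
  lift atW       _ = 0
  lift elsewhere k = k

  module Lift {f : Fin n → ℕ} (drdf : IsDRDF G-B f) where

    g : Fin n → ℕ
    g x = lift (role x) (f x)

    g-v : g v ≡ 3
    g-v rewrite role-v = refl

    outside-lifts : ∀ {x} → role x ≡ elsewhere → ∀ y → T (adj G-B x y) → T (adj G x y) × g y ≡ f y
    outside-lifts {x} rx y x~y with same-block x~y
    ... | x~′y , blocks with role x | rx | role y
    ...   | _ | refl | elsewhere = x~′y , refl

    g-bounded : ∀ x → g x ≤ 3
    g-bounded x with role x
    ... | atU       = z≤n
    ... | atV       = ≤-refl
    ... | atW       = z≤n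
    ... | elsewhere = proj₁ drdf x

    g-zero : ∀ x → g x ≡ 0 → ZeroCondition G g x
    g-zero x gx with role x in rx
    ... | atU       = inj₂ (v , subst (λ z → T (adj G z v)) (sym (atU⇒≡u rx)) u~v , g-v)
    ... | atW       = inj₂ (v , subst (λ z → T (adj G z v)) (sym (atW⇒≡w rx)) w~v , g-v)
    ... | elsewhere = transfer-zero G-B G (outside-lifts rx) (proj₁ (proj₂ drdf) x gx)

    g-one : ∀ x → g x ≡ 1 → OneCondition G g x
    g-one x gx with role x in rx
    ... | elsewhere = transfer-one G-B G (outside-lifts rx) (proj₂ (proj₂ drdf) x gx)

    g-drdf : IsDRDF G g
    g-drdf = g-bounded , g-zero , g-one

    5≤f-on-path : 5 ≤ f u + f v + f w
    5≤f-on-path = +-mono-≤ (isolatedEdge⇒3≤ G-B drdf u-only-v v-only-u) (isolated⇒2≤ G-B drdf w-isolated)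

    ∑g-balance : ∑[ x < n ] g x + (f u + f v + f w) ≡ ∑[ x < n ] f x + 3
    ∑g-balance = begin
      ∑[ x < n ] g x + (f u + f v + f w)
        ≡⟨ cong (∑[ x < n ] g x +_) (∑-roles (λ r x → onPath r (f x)) (λ _ → refl)) ⟨
      ∑[ x < n ] g x + ∑[ x < n ] onPath (role x) (f x)
        ≡⟨ ∑-distrib-+ g (λ x → onPath (role x) (f x)) ⟨
      ∑[ x < n ] (g x + onPath (role x) (f x))
        ≡⟨ sum-cong-≗ (λ x → balance (role x) (f x)) ⟩
      ∑[ x < n ] (f x + lift (role x) 0)
        ≡⟨ ∑-distrib-+ f (λ x → lift (role x) 0) ⟩
      ∑[ x < n ] f x + ∑[ x < n ] lift (role x) 0
        ≡⟨ cong (∑[ x < n ] f x +_) (∑-roles (λ r _ → lift r 0) (λ _ → refl)) ⟩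
      ∑[ x < n ] f x + 3 ∎
      where
      open ≡-Reasoning
      balance : ∀ r k → lift r k + onPath r k ≡ k + lift r 0
      balance atU       k = sym (+-identityʳ k)
      balance atV       k = +-comm 3 k
      balance atW       k = sym (+-identityʳ k)
      balance elsewhere k = refl

    weight-drops : weight g + 2 ≤ weight f
    weight-drops = +-cancelʳ-≤ 3 (weight g + 2) (weight f) (begin
      weight g + 2 + 3                   ≡⟨ +-assoc (weight g) 2 3 ⟩
      weight g + 5                       ≤⟨ +-monoʳ-≤ (weight g) 5≤f-on-path ⟩
      weight g + (f u + f v + f w)       ≡⟨ cong (_+ (f u + f v + f w)) (sum-map-allFin g) ⟩
      ∑[ x < n ] g x + (f u + f v + f w) ≡⟨ ∑g-balance ⟩
      ∑[ x < n ] f x + 3                 ≡⟨ cong (_+ 3) (sum-map-allFin f) ⟨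
      weight f + 3                       ∎)
      where open ≤-Reasoning

  γdR-increases : ∀ k k′ → IsDRDomNumber G k → IsDRDomNumber G-B k′ → k < k′
  γdR-increases k k′ (_ , minimal) ((f , drdf , refl) , _) =
    <-≤-trans (m<m+n k (s≤s z≤n)) (≤-trans (+-monoˡ-≤ 2 (minimal g g-drdf)) weight-drops)
    where open Lift drdf

  bondage≤path-degrees : BondageAtMost G (degree G u + degree G v + degree G w ∸ 3)
  bondage≤path-degrees = B , m+n≤o⇒m≤o∸n (edgeCount B) edgeCount-bound , γdR-increases

bondage-mono : ∀ {n} {G : Graph n} {m m′} → m ≤ m′ → BondageAtMost G m → BondageAtMost G m′
bondage-mono m≤m′ (B , |B|≤m , increases) = B , ≤-trans |B|≤m m≤m′ , increases

foldr-⊓-attained : ∀ {A : Set} (h : A → ℕ) (a : A) (xs : List A) →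
  Σ A λ x → h x ≤ foldr (λ y acc → h y ⊓ acc) (h a) xs
foldr-⊓-attained h a [] = a , ≤-refl
foldr-⊓-attained h a (y ∷ ys) with ⊓-sel (h y) (foldr (λ y acc → h y ⊓ acc) (h a) ys)
... | inj₁ min≡hy = y , ≤-reflexive (sym min≡hy)
... | inj₂ min≡rest with foldr-⊓-attained h a ys
...   | x , hx≤rest = x , subst (h x ≤_) (sym min≡rest) hx≤rest

foldr-⊔-upper : ∀ {A : Set} (h : A → ℕ) {x : A} {xs : List A} → x ∈ xs →
  h x ≤ foldr (λ y acc → h y ⊔ acc) 0 xs
foldr-⊔-upper h (here refl) = m≤m⊔n (h _) _
foldr-⊔-upper h {xs = y ∷ _} (there x∈ys) = m≤n⇒m≤o⊔n (h y) (foldr-⊔-upper h x∈ys)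

min-degree-vertex : ∀ {m} (G : Graph (suc m)) → Σ (Fin (suc m)) λ x → degree G x ≤ δ G
min-degree-vertex {m} G = foldr-⊓-attained (degree G) fzero (allFin (suc m))

degree≤Δ : ∀ {m} (G : Graph (suc m)) x → degree G x ≤ Δ G
degree≤Δ G x = foldr-⊔-upper (degree G) (∈-allFin x)

avoid-two : ∀ {n} → 3 ≤ n → (a b : Fin n) → Σ (Fin n) λ z → z ≢ a × z ≢ b
avoid-two (s≤s (s≤s (s≤s z≤n))) a b with a ≟ b
... | yes a≡b = punchIn a fzero , punchInᵢ≢i a fzero , λ z≡b → punchInᵢ≢i a fzero (trans z≡b (sym a≡b))
... | no a≢b  = punchIn a (punchIn b′ fzero) , punchInᵢ≢i a _ , z≢b
  where
  b′ = punchOut a≢b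
  z≢b : punchIn a (punchIn b′ fzero) ≢ b
  z≢b z≡b = punchInᵢ≢i b′ fzero (punchIn-injective a _ _ (trans z≡b (sym (punchIn-punchOut a≢b))))

module _ {n : ℕ} {G : Graph n} where

  reach-closed : (P : Fin n → Set) → (∀ {x y} → P x → T (adj G x y) → P y) →
    ∀ {a z} → P a → Reach G a z → P z
  reach-closed P closed Pa here           = Pa
  reach-closed P closed Pa (step a~b b↝z) = reach-closed P closed (closed Pa a~b) b↝z

  isolated⇒only-vertex : Connected G → ∀ {x} → Isolated G x → ∀ z → z ≡ x
  isolated⇒only-vertex connected {x} isolated z =
    sym (reach-closed (x ≡_) (λ { refl x~y → contradiction x~y (isolated _) }) refl (connected x z))

  isolated-edge⇒only-vertices : Connected G → ∀ {x y} → AdjacentOnlyTo G x y → AdjacentOnlyTo G y x →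
    ∀ z → z ≡ x ⊎ z ≡ y
  isolated-edge⇒only-vertices connected {x} {y} x-y y-x z =
    reach-closed (λ t → t ≡ x ⊎ t ≡ y) closed (inj₁ refl) (connected x z)
    where
    closed : ∀ {s t} → s ≡ x ⊎ s ≡ y → T (adj G s t) → t ≡ x ⊎ t ≡ y
    closed (inj₁ refl) s~t = inj₂ (x-y _ s~t)
    closed (inj₂ refl) s~t = inj₁ (y-x _ s~t)

  adjacentOnlyTo? : ∀ x y → (Σ (Fin n) λ z → T (adj G x z) × z ≢ y) ⊎ AdjacentOnlyTo G x y
  adjacentOnlyTo? x y with any? (λ z → T? (adj G x z) ×-dec ¬? (z ≟ y))
  ... | yes other = inj₁ other
  ... | no none   = inj₂ λ z x~z → decidable-stable (z ≟ y) (λ z≢y → none (z , x~z , z≢y))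

  has-neighbour : Connected G → 3 ≤ n → ∀ x → Σ (Fin n) λ y → T (adj G x y)
  has-neighbour connected n≥3 x with any? (λ y → T? (adj G x y))
  ... | yes neighbour = neighbour
  ... | no isolated   =
    let z , z≢x , _ = avoid-two n≥3 x x
    in contradiction (isolated⇒only-vertex connected (λ y x~y → isolated (y , x~y)) z) z≢x

  P₃-through : Connected G → 3 ≤ n → ∀ x → Σ (P₃ G) λ p → x ≡ P₃.u p ⊎ x ≡ P₃.v p
  P₃-through connected n≥3 x with has-neighbour connected n≥3 x
  ... | y , x~y with adjacentOnlyTo? y x
  ...   | inj₁ (z , y~z , z≢x) = record { u~v = x~y ; w~v = adj-sym G y~z ; w≢u = z≢x } , inj₁ refl
  ...   | inj₂ y-x with adjacentOnlyTo? x y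
  ...     | inj₁ (z , x~z , z≢y) = record { u~v = adj-sym G x~y ; w~v = adj-sym G x~z ; w≢u = z≢y } , inj₂ refl
  ...     | inj₂ x-y with avoid-two n≥3 x y
  ...       | z , z≢x , z≢y = ⊥-elim ([ z≢x , z≢y ]′ (isolated-edge⇒only-vertices connected x-y y-x z))

m+n+n≡m+2*n : ∀ m n → m + n + n ≡ m + 2 * n
m+n+n≡m+2*n = solve-∀

n+m+n≡m+2*n : ∀ m n → n + m + n ≡ m + 2 * n
n+m+n≡m+2*n = solve-∀

module _ {m : ℕ} {G : Graph (suc m)} (p : P₃ G) where
  open P₃ p

  path-degrees≤ : ∀ {x} → x ≡ u ⊎ x ≡ v → degree G x ≤ δ G →
    degree G u + degree G v + degree G w ≤ δ G + 2 * Δ G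
  path-degrees≤ (inj₁ refl) x≤δ =
    ≤-trans (+-mono-≤ (+-mono-≤ x≤δ (degree≤Δ G v)) (degree≤Δ G w)) (≤-reflexive (m+n+n≡m+2*n (δ G) (Δ G)))
  path-degrees≤ (inj₂ refl) x≤δ =
    ≤-trans (+-mono-≤ (+-mono-≤ (degree≤Δ G u) x≤δ) (degree≤Δ G w)) (≤-reflexive (n+m+n≡m+2*n (δ G) (Δ G)))

corollary3p2 : (m : ℕ) → (G : Graph (suc m)) → 3 ≤ suc m → Connected G →
    BondageAtMost G (δ G + 2 * Δ G ∸ 3)
corollary3p2 m G n≥3 connected =
  let x , x≤δ    = min-degree-vertex G
      p , x-on-p = P₃-through connected n≥3 x
  in bondage-mono (∸-monoˡ-≤ 3 (path-degrees≤ p x-on-p x≤δ)) (PathConstruction.bondage≤path-degrees p)
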